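{- Let $n \ge 3$ be odd, let $f \in S_{1,1}(n)$ and let $g \in S_{0,0}(n)$. Then: (i) $\psi(f) \in S_{0,0}(n)$ if $\sigma_f = 1$, and $\psi(f) \in S_{0,1}(n)$ if $\sigma_f = 0$; (ii) $\psi^{ -1}(f) \in S_{0,0}(n)$ if $\sigma_f = 0$, and $\psi^{ -1}(f) \in S_{1,0}(n)$ if $\sigma_f = 1$; (iii) $\psi(g) \in S_{1,1}(n)$ if $\sigma_g = 1$, and $\psi(g) \in S_{1,0}(n)$ if $\sigma_g = 0$; (iv) $\psi^{ -1}(g) \in S_{1,1}(n)$ if $\sigma_g = 0$, and $\psi^{ -1}(g) \in S_{0,1}(n)$ if $\sigma_g = 1$.
   Context: For $n \ge 2$, let $\mathcal{I}_n$ be the set of all monic irreducible polynomials of degree $n$ in $\mathbb{F}_2[x]$. Every $f \in \mathcal{I}_n$ has nonzero constant term and is written $f = x^n + f_{n-1}x^{n-1} + \cdots + f_1 x + 1$ with $f_k \in \mathbb{F}_2$. For $i,j \in \mathbb{F}_2$, let $S_{i,j}(n) = \{ f \in \mathcal{I}_n : f_{n-1} = i,\ f_1 = j\}$. Define $\psi : \mathcal{I}_n \to \mathcal{I}_n$ by $\psi(f) = (x+1)^n f\!\left(\frac{1}{x+1}\right)$; its inverse is $\psi^{ -1}(f) = x^n f\!\left(\frac{x+1}{x}\right)$. The signature of $f \in \mathcal{I}_n$ is $\sigma_f = \sum_{k=2}^{n-2} k f_k \pmod 2 \in \mathbb{F}_2$. -}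

module Defs where

open import Data.Bool using (Bool; true; false; _xor_; _∧_; if_then_else_)
open import Data.Nat using (ℕ; zero; suc; _+_; _∸_; _≤_; _<_)
open import Data.Nat.Properties using ()
open import Data.List using (List; []; _∷_; length; upTo; foldr; map; replicate)
open import Data.Product using (Σ; _×_; _,_; ∃)
open import Relation.Nullary using (¬_)
open import Relation.Binary.PropositionalEquality using (_≡_)

-- Polynomials over F₂ = Bool (xor as +, ∧ as ·), as coefficient lists,
-- lowest degree first. Trailing zeros are allowed; polynomials are compared
-- coefficientwise via _≈ₚ_.
Poly : Set
Poly = List Bool

coeff : Poly → ℕ → Bool
coeff []       _       = false
coeff (a ∷ p)  zero    = a
coeff (a ∷ p)  (suc k) = coeff p k

_+ₚ_ : Poly → Poly → Poly
[]      +ₚ q       = q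
(a ∷ p) +ₚ []      = a ∷ p
(a ∷ p) +ₚ (b ∷ q) = (a xor b) ∷ (p +ₚ q)

scale : Bool → Poly → Poly
scale c p = map (c ∧_) p

_*ₚ_ : Poly → Poly → Poly
[]      *ₚ q = []
(a ∷ p) *ₚ q = scale a q +ₚ (false ∷ (p *ₚ q))

_^ₚ_ : Poly → ℕ → Poly
p ^ₚ zero  = true ∷ []
p ^ₚ suc k = p *ₚ (p ^ₚ k)

X : Poly
X = false ∷ true ∷ []

X+1 : Poly
X+1 = true ∷ true ∷ []

_≈ₚ_ : Poly → Poly → Set
p ≈ₚ q = ∀ k → coeff p k ≡ coeff q k

MonicDeg : ℕ → Poly → Set
MonicDeg d p = (coeff p d ≡ true) × (∀ k → d < k → coeff p k ≡ false)

-- f is a monic irreducible polynomial of degree n in F₂[x]: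
-- monic of degree n ≥ 1 and not a product of two polynomials of positive
-- degree (over F₂ every nonzero polynomial is monic, so factors are monic).
Irreducible : ℕ → Poly → Set
Irreducible n f =
  (1 ≤ n) × MonicDeg n f ×
  ¬ (Σ ℕ λ d → Σ ℕ λ e → Σ Poly λ a → Σ Poly λ b →
       (1 ≤ d) × (1 ≤ e) × MonicDeg d a × MonicDeg e b × ((a *ₚ b) ≈ₚ f))

S : Bool → Bool → ℕ → Poly → Set
S i j n f = Irreducible n f × (coeff f (n ∸ 1) ≡ i) × (coeff f 1 ≡ j)

sumₚ : (ℕ → Poly) → List ℕ → Poly
sumₚ g ks = foldr (λ k acc → g k +ₚ acc) [] ks

-- ψ(f) = (x+1)^n f(1/(x+1)) = Σ_{k=0}^{n} f_k (x+1)^{n-k}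
ψ : ℕ → Poly → Poly
ψ n f = sumₚ (λ k → scale (coeff f k) (X+1 ^ₚ (n ∸ k))) (upTo (suc n))

-- ψ⁻¹(f) = x^n f((x+1)/x) = Σ_{k=0}^{n} f_k (x+1)^k x^{n-k}
ψinv : ℕ → Poly → Poly
ψinv n f = sumₚ (λ k → scale (coeff f k) ((X+1 ^ₚ k) *ₚ (X ^ₚ (n ∸ k)))) (upTo (suc n))

parity : ℕ → Bool
parity zero          = false
parity (suc zero)    = true
parity (suc (suc k)) = parity k

σ : ℕ → Poly → Bool
σ n f = foldr (λ k acc → (parity k ∧ coeff f k) xor acc) false
              (map (2 +_) (upTo (n ∸ 3)))

Odd : ℕ → Set
Odd n = parity n ≡ true

-- ψ and ψ⁻¹ are instances (u, v) = (1, x+1) and (x+1, x) of the homogenisation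
-- p ↦ Σₖ pₖ uᵏ vⁿ⁻ᵏ = vⁿ p(u/v) for polynomials u, v of degree at most 1. Homogenisation is
-- multiplicative, preserves degree bounds and composes like the Möbius maps x ↦ u/v, and
-- the two instances are mutually inverse; so a factorisation of ψ(f) or ψ⁻¹(f) into monic
-- factors pulls back to one of f, and both maps preserve irreducibility.
--
-- The classes then come from four coefficients, read off mod 2 from the binomial
-- expansion of (x+1)ᵐ:  ψ(f)ₙ₋₁ = n f₀ + f₁,  ψ(f)₁ = Σₖ (n−k) fₖ = f(1) + f′(1),
-- ψ⁻¹(f)ₙ₋₁ = f′(1),  ψ⁻¹(f)₁ = fₙ₋₁ + n fₙ.  Here f₀ = 1, f(1) = 1 because it is the
-- constant term of the irreducible ψ(f), and f′(1) = f₁ + σ_f + 1 for odd n.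

module Submission where

open import Defs
open import Algebra.Bundles using (CommutativeMonoid; CommutativeSemiring; CommutativeRing)
open import Data.Bool using (Bool; true; false; not; _xor_; _∧_)
open import Data.Bool.Properties
  using (xor-identityʳ; xor-comm; xor-assoc; ∧-zeroʳ; ∧-identityʳ; ∧-comm; ∧-assoc;
         ∧-distribˡ-xor; ∧-distribʳ-xor; xor-∧-commutativeRing; not-involutive; not-distribʳ-xor)
open import Data.Nat using (ℕ; zero; suc; _+_; _∸_; _≤_; _<_; z≤n; s≤s)
open import Data.Nat.Properties
  using (≤-<-trans; m≤n+m; ∸-+-assoc; <-cmp; m∸n+n≡m; m∸n≤m; n<1+n; +-∸-assoc; m+n∸n≡m; n∸n≡0)
open import Data.List using ([]; _∷_; applyUpTo; upTo; foldr)
open import Data.List.Properties using (foldr-map)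
open import Function using (_∘_; id)
open import Data.Product using (_×_; _,_; proj₁; proj₂)
open import Data.Empty using (⊥-elim)
open import Relation.Nullary using (¬_)
open import Relation.Binary.Definitions using (tri<; tri≈; tri>)
open import Level using (0ℓ)
open import Relation.Binary.Bundles using (Setoid)
open import Relation.Binary.Structures using (IsEquivalence)
open import Relation.Binary.PropositionalEquality
  using (_≡_; refl; sym; trans; cong; cong₂)

-- Coefficientwise equality is boxed in a record (as are degree bounds and monicity
-- below) so that the polynomials involved can be inferred from a proof.
infix 4 _≈_
record _≈_ (p q : Poly) : Set where
  constructor mk≈
  field coeff-≈ : p ≈ₚ q
open _≈_ public

≈-refl : ∀ {p} → p ≈ p
≈-refl = mk≈ λ _ → refl

≈-sym : ∀ {p q} → p ≈ q → q ≈ p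
≈-sym (mk≈ e) = mk≈ λ k → sym (e k)

≈-trans : ∀ {p q r} → p ≈ q → q ≈ r → p ≈ r
≈-trans (mk≈ e) (mk≈ e′) = mk≈ λ k → trans (e k) (e′ k)

≡⇒≈ : ∀ {p q} → p ≡ q → p ≈ q
≡⇒≈ refl = ≈-refl

≈-isEquivalence : IsEquivalence _≈_
≈-isEquivalence = record { refl = ≈-refl ; sym = ≈-sym ; trans = ≈-trans }

≈-setoid : Setoid 0ℓ 0ℓ
≈-setoid = record { isEquivalence = ≈-isEquivalence }

open import Relation.Binary.Reasoning.Setoid ≈-setoid

coeff-+ : ∀ p q k → coeff (p +ₚ q) k ≡ coeff p k xor coeff q k
coeff-+ []      q       k       = refl
coeff-+ (a ∷ p) []      zero    = sym (xor-identityʳ a)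
coeff-+ (a ∷ p) []      (suc k) = sym (xor-identityʳ _)
coeff-+ (a ∷ p) (b ∷ q) zero    = refl
coeff-+ (a ∷ p) (b ∷ q) (suc k) = coeff-+ p q k

coeff-scale : ∀ c p k → coeff (scale c p) k ≡ c ∧ coeff p k
coeff-scale c []      k       = sym (∧-zeroʳ c)
coeff-scale c (a ∷ p) zero    = refl
coeff-scale c (a ∷ p) (suc k) = coeff-scale c p k

∷-cong : ∀ {a b p q} → a ≡ b → p ≈ q → a ∷ p ≈ b ∷ q
∷-cong a≡b (mk≈ e) = mk≈ λ { zero → a≡b ; (suc k) → e k }

-- Arithmetic of F₂[x] up to coefficientwise equality

+-cong : ∀ {p p′ q q′} → p ≈ p′ → q ≈ q′ → p +ₚ q ≈ p′ +ₚ q′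
+-cong {p} {p′} {q} {q′} (mk≈ e) (mk≈ e′) = mk≈ λ k →
  trans (coeff-+ p q k) (trans (cong₂ _xor_ (e k) (e′ k)) (sym (coeff-+ p′ q′ k)))

+-comm : ∀ p q → p +ₚ q ≈ q +ₚ p
+-comm p q = mk≈ λ k →
  trans (coeff-+ p q k) (trans (xor-comm (coeff p k) (coeff q k)) (sym (coeff-+ q p k)))

+-assoc : ∀ p q r → (p +ₚ q) +ₚ r ≈ p +ₚ (q +ₚ r)
+-assoc p q r = mk≈ λ k → trans (coeff-+ (p +ₚ q) r k)
  (trans (cong (_xor coeff r k) (coeff-+ p q k))
  (trans (xor-assoc (coeff p k) (coeff q k) (coeff r k))
  (trans (cong (coeff p k xor_) (sym (coeff-+ q r k))) (sym (coeff-+ p (q +ₚ r) k)))))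

+-identityʳ : ∀ p → p +ₚ [] ≈ p
+-identityʳ p = mk≈ λ k → trans (coeff-+ p [] k) (xor-identityʳ _)

+-commutativeMonoid : CommutativeMonoid 0ℓ 0ℓ
+-commutativeMonoid = record
  { Carrier = Poly ; _≈_ = _≈_ ; _∙_ = _+ₚ_ ; ε = []
  ; isCommutativeMonoid = record
    { isMonoid = record
      { isSemigroup = record
        { isMagma = record { isEquivalence = ≈-isEquivalence ; ∙-cong = +-cong }
        ; assoc = +-assoc }
      ; identity = (λ _ → ≈-refl) , +-identityʳ }
    ; comm = +-comm } }

open import Algebra.Properties.CommutativeSemigroup
  (CommutativeMonoid.commutativeSemigroup +-commutativeMonoid)
  using () renaming (interchange to +-interchange; x∙yz≈y∙xz to +-leftSwap)

scale-cong : ∀ c {p q} → p ≈ q → scale c p ≈ scale c q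
scale-cong c {p} {q} (mk≈ e) = mk≈ λ k →
  trans (coeff-scale c p k) (trans (cong (c ∧_) (e k)) (sym (coeff-scale c q k)))

scale-false : ∀ p → scale false p ≈ []
scale-false p = mk≈ (coeff-scale false p)

scale-true : ∀ p → scale true p ≈ p
scale-true p = mk≈ (coeff-scale true p)

scale-xor : ∀ a b p → scale (a xor b) p ≈ scale a p +ₚ scale b p
scale-xor a b p = mk≈ λ k → trans (coeff-scale (a xor b) p k)
  (trans (∧-distribʳ-xor (coeff p k) a b)
  (sym (trans (coeff-+ (scale a p) (scale b p) k)
              (cong₂ _xor_ (coeff-scale a p k) (coeff-scale b p k)))))

scale-∧ : ∀ a b p → scale (a ∧ b) p ≈ scale a (scale b p)
scale-∧ a b p = mk≈ λ k → trans (coeff-scale (a ∧ b) p k)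
  (trans (∧-assoc a b (coeff p k))
  (sym (trans (coeff-scale a (scale b p) k) (cong (a ∧_) (coeff-scale b p k)))))

scale-+ : ∀ c p q → scale c (p +ₚ q) ≈ scale c p +ₚ scale c q
scale-+ c p q = mk≈ λ k → trans (coeff-scale c (p +ₚ q) k)
  (trans (cong (c ∧_) (coeff-+ p q k))
  (trans (∧-distribˡ-xor c (coeff p k) (coeff q k))
  (sym (trans (coeff-+ (scale c p) (scale c q) k)
              (cong₂ _xor_ (coeff-scale c p k) (coeff-scale c q k))))))

one : Poly
one = true ∷ []

∷-zero : ∀ {p} → p ≈ [] → false ∷ p ≈ []
∷-zero (mk≈ e) = mk≈ λ { zero → refl ; (suc k) → e k }

*-zeroʳ : ∀ p → p *ₚ [] ≈ []
*-zeroʳ []      = ≈-refl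
*-zeroʳ (a ∷ p) = ∷-zero (*-zeroʳ p)

*-congʳ : ∀ p {q q′} → q ≈ q′ → p *ₚ q ≈ p *ₚ q′
*-congʳ []      q≈q′ = ≈-refl
*-congʳ (a ∷ p) q≈q′ = +-cong (scale-cong a q≈q′) (∷-cong refl (*-congʳ p q≈q′))

*-≈[]ʳ : ∀ p {q} → q ≈ [] → p *ₚ q ≈ []
*-≈[]ʳ p q≈[] = ≈-trans (*-congʳ p q≈[]) (*-zeroʳ p)

*-consʳ : ∀ p a q → p *ₚ (a ∷ q) ≈ scale a p +ₚ (false ∷ p *ₚ q)
*-consʳ []      a q = ≈-sym (∷-zero ≈-refl)
*-consʳ (b ∷ p) a q = ∷-cong (cong (_xor false) (∧-comm b a)) (begin
  scale b q +ₚ (p *ₚ (a ∷ q))                    ≈⟨ +-cong ≈-refl (*-consʳ p a q) ⟩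
  scale b q +ₚ (scale a p +ₚ (false ∷ p *ₚ q))   ≈⟨ +-leftSwap (scale b q) (scale a p) _ ⟩
  scale a p +ₚ (scale b q +ₚ (false ∷ p *ₚ q))   ∎)

*-comm : ∀ p q → p *ₚ q ≈ q *ₚ p
*-comm []      q = ≈-sym (*-zeroʳ q)
*-comm (a ∷ p) q = begin
  scale a q +ₚ (false ∷ p *ₚ q)  ≈⟨ +-cong ≈-refl (∷-cong refl (*-comm p q)) ⟩
  scale a q +ₚ (false ∷ q *ₚ p)  ≈⟨ ≈-sym (*-consʳ q a p) ⟩
  q *ₚ (a ∷ p)                   ∎

*-congˡ : ∀ {p p′} q → p ≈ p′ → p *ₚ q ≈ p′ *ₚ q
*-congˡ {p} {p′} q p≈p′ = begin
  p *ₚ q   ≈⟨ *-comm p q ⟩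
  q *ₚ p   ≈⟨ *-congʳ q p≈p′ ⟩
  q *ₚ p′  ≈⟨ *-comm q p′ ⟩
  p′ *ₚ q  ∎

*-cong : ∀ {p p′ q q′} → p ≈ p′ → q ≈ q′ → p *ₚ q ≈ p′ *ₚ q′
*-cong {p′ = p′} {q} p≈p′ q≈q′ = ≈-trans (*-congˡ q p≈p′) (*-congʳ p′ q≈q′)

*-distribʳ : ∀ r p q → (p +ₚ q) *ₚ r ≈ (p *ₚ r) +ₚ (q *ₚ r)
*-distribʳ r []      q       = ≈-refl
*-distribʳ r (a ∷ p) []      = ≈-sym (+-identityʳ _)
*-distribʳ r (a ∷ p) (b ∷ q) = begin
  scale (a xor b) r +ₚ (false ∷ (p +ₚ q) *ₚ r)
    ≈⟨ +-cong (scale-xor a b r) (∷-cong refl (*-distribʳ r p q)) ⟩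
  (scale a r +ₚ scale b r) +ₚ ((false ∷ p *ₚ r) +ₚ (false ∷ q *ₚ r))
    ≈⟨ +-interchange (scale a r) (scale b r) _ _ ⟩
  ((a ∷ p) *ₚ r) +ₚ ((b ∷ q) *ₚ r) ∎

*-distribˡ : ∀ p q r → p *ₚ (q +ₚ r) ≈ (p *ₚ q) +ₚ (p *ₚ r)
*-distribˡ p q r = begin
  p *ₚ (q +ₚ r)        ≈⟨ *-comm p (q +ₚ r) ⟩
  (q +ₚ r) *ₚ p        ≈⟨ *-distribʳ p q r ⟩
  (q *ₚ p) +ₚ (r *ₚ p) ≈⟨ +-cong (*-comm q p) (*-comm r p) ⟩
  (p *ₚ q) +ₚ (p *ₚ r) ∎

scale-*ˡ : ∀ c p q → scale c p *ₚ q ≈ scale c (p *ₚ q)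
scale-*ˡ c []      q = ≈-refl
scale-*ˡ c (a ∷ p) q = begin
  scale (c ∧ a) q +ₚ (false ∷ scale c p *ₚ q)
    ≈⟨ +-cong (scale-∧ c a q) (∷-cong (sym (∧-zeroʳ c)) (scale-*ˡ c p q)) ⟩
  scale c (scale a q) +ₚ scale c (false ∷ p *ₚ q)
    ≈⟨ ≈-sym (scale-+ c (scale a q) _) ⟩
  scale c ((a ∷ p) *ₚ q) ∎

scale-*ʳ : ∀ c p q → p *ₚ scale c q ≈ scale c (p *ₚ q)
scale-*ʳ c p q = begin
  p *ₚ scale c q    ≈⟨ *-comm p (scale c q) ⟩
  scale c q *ₚ p    ≈⟨ scale-*ˡ c q p ⟩
  scale c (q *ₚ p)  ≈⟨ scale-cong c (*-comm q p) ⟩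
  scale c (p *ₚ q)  ∎

shift-*ˡ : ∀ p q → (false ∷ p) *ₚ q ≈ false ∷ p *ₚ q
shift-*ˡ p q = +-cong (scale-false q) ≈-refl

*-assoc : ∀ p q r → (p *ₚ q) *ₚ r ≈ p *ₚ (q *ₚ r)
*-assoc []      q r = ≈-refl
*-assoc (a ∷ p) q r = begin
  (scale a q +ₚ (false ∷ p *ₚ q)) *ₚ r
    ≈⟨ *-distribʳ r (scale a q) _ ⟩
  (scale a q *ₚ r) +ₚ ((false ∷ p *ₚ q) *ₚ r)
    ≈⟨ +-cong (scale-*ˡ a q r) (≈-trans (shift-*ˡ (p *ₚ q) r) (∷-cong refl (*-assoc p q r))) ⟩
  scale a (q *ₚ r) +ₚ (false ∷ p *ₚ (q *ₚ r)) ∎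

*-identityˡ : ∀ p → one *ₚ p ≈ p
*-identityˡ p = ≈-trans (+-cong (scale-true p) (∷-zero ≈-refl)) (+-identityʳ p)

*-identityʳ : ∀ p → p *ₚ one ≈ p
*-identityʳ p = ≈-trans (*-comm p one) (*-identityˡ p)

Poly-commutativeSemiring : CommutativeSemiring 0ℓ 0ℓ
Poly-commutativeSemiring = record
  { Carrier = Poly ; _≈_ = _≈_ ; _+_ = _+ₚ_ ; _*_ = _*ₚ_ ; 0# = [] ; 1# = one
  ; isCommutativeSemiring = record
    { isSemiring = record
      { isSemiringWithoutAnnihilatingZero = record
        { +-isCommutativeMonoid = CommutativeMonoid.isCommutativeMonoid +-commutativeMonoid
        ; *-cong = *-cong
        ; *-assoc = *-assoc
        ; *-identity = *-identityˡ , *-identityʳ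
        ; distrib = *-distribˡ , *-distribʳ }
      ; zero = (λ _ → ≈-refl) , *-zeroʳ }
    ; *-comm = *-comm } }

open import Algebra.Properties.CommutativeSemigroup
  (CommutativeSemiring.*-commutativeSemigroup Poly-commutativeSemiring)
  using () renaming (x∙yz≈y∙xz to *-leftSwap)
open import Algebra.Properties.CommutativeSemigroup
  (CommutativeRing.+-commutativeSemigroup xor-∧-commutativeRing)
  using () renaming (interchange to xor-interchange)

^-congˡ : ∀ m {p q} → p ≈ q → p ^ₚ m ≈ q ^ₚ m
^-congˡ zero    p≈q = ≈-refl
^-congˡ (suc m) p≈q = *-cong p≈q (^-congˡ m p≈q)

one-^ : ∀ m → one ^ₚ m ≈ one
one-^ zero    = ≈-refl
one-^ (suc m) = ≈-trans (*-identityˡ _) (one-^ m)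

X-* : ∀ p → X *ₚ p ≈ false ∷ p
X-* p = ≈-trans (shift-*ˡ one p) (∷-cong refl (*-identityˡ p))

-- Degree bounds

record Deg≤ (d : ℕ) (p : Poly) : Set where
  constructor mkDeg≤
  field coeff-above : ∀ k → d < k → coeff p k ≡ false
open Deg≤ public

Deg≤-resp-≈ : ∀ {d p q} → p ≈ q → Deg≤ d p → Deg≤ d q
Deg≤-resp-≈ (mk≈ e) (mkDeg≤ dp) = mkDeg≤ λ k d<k → trans (sym (e k)) (dp k d<k)

Deg≤-weaken : ∀ {d d′ p} → d ≤ d′ → Deg≤ d p → Deg≤ d′ p
Deg≤-weaken d≤d′ (mkDeg≤ dp) = mkDeg≤ λ k d′<k → dp k (≤-<-trans d≤d′ d′<k)

Deg≤-zero : ∀ {d p} → p ≈ [] → Deg≤ d p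
Deg≤-zero (mk≈ e) = mkDeg≤ λ k _ → e k

Deg≤-+ : ∀ {d p q} → Deg≤ d p → Deg≤ d q → Deg≤ d (p +ₚ q)
Deg≤-+ {p = p} {q} (mkDeg≤ dp) (mkDeg≤ dq) = mkDeg≤ λ k d<k →
  trans (coeff-+ p q k) (cong₂ _xor_ (dp k d<k) (dq k d<k))

Deg≤-scale : ∀ {d} c {p} → Deg≤ d p → Deg≤ d (scale c p)
Deg≤-scale c {p} (mkDeg≤ dp) = mkDeg≤ λ k d<k →
  trans (coeff-scale c p k) (trans (cong (c ∧_) (dp k d<k)) (∧-zeroʳ c))

Deg≤-∷ : ∀ {d c p} → Deg≤ d p → Deg≤ (suc d) (c ∷ p)
Deg≤-∷ (mkDeg≤ dp) = mkDeg≤ λ { (suc k) (s≤s d<k) → dp k d<k }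

Deg≤-tail : ∀ {d c p} → Deg≤ d (c ∷ p) → Deg≤ (d ∸ 1) p
Deg≤-tail {zero}  (mkDeg≤ dp) = mkDeg≤ λ k _   → dp (suc k) (s≤s z≤n)
Deg≤-tail {suc d} (mkDeg≤ dp) = mkDeg≤ λ k d<k → dp (suc k) (s≤s d<k)

Deg≤0-tail : ∀ {c p} → Deg≤ 0 (c ∷ p) → p ≈ []
Deg≤0-tail (mkDeg≤ dp) = mk≈ λ k → dp (suc k) (s≤s z≤n)

Deg≤0-* : ∀ {c a} b → Deg≤ 0 (c ∷ a) → (c ∷ a) *ₚ b ≈ scale c b
Deg≤0-* {c} {a} b da = begin
  scale c b +ₚ (false ∷ a *ₚ b) ≈⟨ +-cong ≈-refl (∷-zero (*-congˡ b (Deg≤0-tail da))) ⟩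
  scale c b +ₚ []               ≈⟨ +-identityʳ (scale c b) ⟩
  scale c b                     ∎

Deg≤-* : ∀ {d e a b} → Deg≤ d a → Deg≤ e b → Deg≤ (d + e) (a *ₚ b)
Deg≤-* {a = []}                     da db = mkDeg≤ λ _ _ → refl
Deg≤-* {zero}      {a = c ∷ a} {b} da db = Deg≤-resp-≈ (≈-sym (Deg≤0-* b da)) (Deg≤-scale c db)
Deg≤-* {suc d} {e} {a = c ∷ a}     da db =
  Deg≤-+ (Deg≤-scale c (Deg≤-weaken (m≤n+m e (suc d)) db)) (Deg≤-∷ (Deg≤-* (Deg≤-tail da) db))

coeff-*-top : ∀ {d e a b} → Deg≤ d a → Deg≤ e b → coeff (a *ₚ b) (d + e) ≡ coeff a d ∧ coeff b e
coeff-*-top {a = []}                da db = refl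
coeff-*-top {zero}  {e} {c ∷ a} {b} da db = trans (coeff-≈ (Deg≤0-* b da) e) (coeff-scale c b e)
coeff-*-top {suc d} {e} {c ∷ a} {b} da db =
  trans (coeff-+ (scale c b) (false ∷ a *ₚ b) (suc (d + e)))
        (cong₂ _xor_ (coeff-above (Deg≤-scale c db) (suc (d + e)) (s≤s (m≤n+m e d)))
                     (coeff-*-top (Deg≤-tail da) db))

Deg≤-^ : ∀ {u} m → Deg≤ 1 u → Deg≤ m (u ^ₚ m)
Deg≤-^ zero    du = mkDeg≤ λ { (suc k) _ → refl }
Deg≤-^ (suc m) du = Deg≤-* du (Deg≤-^ m du)

coeff-^-top : ∀ {u} m → Deg≤ 1 u → coeff u 1 ≡ true → coeff (u ^ₚ m) m ≡ true
coeff-^-top zero    du u₁ = refl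
coeff-^-top (suc m) du u₁ =
  trans (coeff-*-top du (Deg≤-^ m du)) (cong₂ _∧_ u₁ (coeff-^-top m du u₁))

-- Homogenisation

-- homog u v d p = Σₖ pₖ uᵏ vᵈ⁻ᵏ, i.e. vᵈ p(u/v) when deg p ≤ d.
homog : Poly → Poly → ℕ → Poly → Poly
homog u v d []      = []
homog u v d (c ∷ p) = scale c (v ^ₚ d) +ₚ (u *ₚ homog u v (d ∸ 1) p)

module Homog (u v : Poly) where

  H : ℕ → Poly → Poly
  H = homog u v

  H-zero : ∀ d {p} → p ≈ [] → H d p ≈ []
  H-zero d {[]}    _       = ≈-refl
  H-zero d {c ∷ p} (mk≈ e) with e 0
  ... | refl = +-cong (scale-false (v ^ₚ d))
                      (≈-trans (*-congʳ u (H-zero (d ∸ 1) {p} (mk≈ λ k → e (suc k)))) (*-zeroʳ u))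

  H-cong : ∀ d {p q} → p ≈ q → H d p ≈ H d q
  H-cong d {[]}    {[]}    _   = ≈-refl
  H-cong d {[]}    {_ ∷ _} []≈q = ≈-sym (H-zero d (≈-sym []≈q))
  H-cong d {_ ∷ _} {[]}    p≈[] = H-zero d p≈[]
  H-cong d {a ∷ p} {b ∷ q} (mk≈ e) with e 0
  ... | refl = +-cong ≈-refl (*-congʳ u (H-cong (d ∸ 1) {p} {q} (mk≈ λ k → e (suc k))))

  H-+ : ∀ d p q → H d (p +ₚ q) ≈ H d p +ₚ H d q
  H-+ d []      q       = ≈-refl
  H-+ d (a ∷ p) []      = ≈-sym (+-identityʳ _)
  H-+ d (a ∷ p) (b ∷ q) = begin
    scale (a xor b) (v ^ₚ d) +ₚ (u *ₚ H (d ∸ 1) (p +ₚ q))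
      ≈⟨ +-cong (scale-xor a b (v ^ₚ d))
                (≈-trans (*-congʳ u (H-+ (d ∸ 1) p q)) (*-distribˡ u _ _)) ⟩
    (scale a (v ^ₚ d) +ₚ scale b (v ^ₚ d)) +ₚ ((u *ₚ H (d ∸ 1) p) +ₚ (u *ₚ H (d ∸ 1) q))
      ≈⟨ +-interchange (scale a (v ^ₚ d)) _ _ _ ⟩
    H d (a ∷ p) +ₚ H d (b ∷ q) ∎

  H-scale : ∀ d c p → H d (scale c p) ≈ scale c (H d p)
  H-scale d c []      = ≈-refl
  H-scale d c (a ∷ p) = begin
    scale (c ∧ a) (v ^ₚ d) +ₚ (u *ₚ H (d ∸ 1) (scale c p))
      ≈⟨ +-cong (scale-∧ c a (v ^ₚ d))
                (≈-trans (*-congʳ u (H-scale (d ∸ 1) c p)) (scale-*ʳ c u _)) ⟩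
    scale c (scale a (v ^ₚ d)) +ₚ scale c (u *ₚ H (d ∸ 1) p)
      ≈⟨ ≈-sym (scale-+ c (scale a (v ^ₚ d)) (u *ₚ H (d ∸ 1) p)) ⟩
    scale c (H d (a ∷ p)) ∎

  H-suc : ∀ m {p} → Deg≤ m p → H (suc m) p ≈ v *ₚ H m p
  H-suc m {[]}    dp = ≈-sym (*-zeroʳ v)
  H-suc m {c ∷ p} dp = begin
    scale c (v *ₚ (v ^ₚ m)) +ₚ (u *ₚ H m p)
      ≈⟨ +-cong (≈-sym (scale-*ʳ c v (v ^ₚ m))) (lower m dp) ⟩
    (v *ₚ scale c (v ^ₚ m)) +ₚ (v *ₚ (u *ₚ H (m ∸ 1) p))
      ≈⟨ ≈-sym (*-distribˡ v _ _) ⟩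
    v *ₚ H m (c ∷ p) ∎
    where
    lower : ∀ m → Deg≤ m (c ∷ p) → u *ₚ H m p ≈ v *ₚ (u *ₚ H (m ∸ 1) p)
    lower zero    dp = ≈-trans u*H≈[] (≈-sym (*-≈[]ʳ v u*H≈[]))
      where u*H≈[] = *-≈[]ʳ u (H-zero 0 (Deg≤0-tail dp))
    lower (suc m) dp = ≈-trans (*-congʳ u (H-suc m (Deg≤-tail dp))) (*-leftSwap u v _)

  H-pad : ∀ d {e p} → Deg≤ e p → H (d + e) p ≈ (v ^ₚ d) *ₚ H e p
  H-pad zero    {e} {p} dp = ≈-sym (*-identityˡ (H e p))
  H-pad (suc d) {e} {p} dp = begin
    H (suc (d + e)) p          ≈⟨ H-suc (d + e) (Deg≤-weaken (m≤n+m e d) dp) ⟩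
    v *ₚ H (d + e) p           ≈⟨ *-congʳ v (H-pad d dp) ⟩
    v *ₚ ((v ^ₚ d) *ₚ H e p)   ≈⟨ ≈-sym (*-assoc v (v ^ₚ d) (H e p)) ⟩
    (v ^ₚ suc d) *ₚ H e p      ∎

  H-* : ∀ d e {a b} → Deg≤ d a → Deg≤ e b → H (d + e) (a *ₚ b) ≈ H d a *ₚ H e b
  H-* d e {[]}    {b} da db = ≈-refl
  H-* d e {c ∷ a} {b} da db = begin
    H (d + e) (scale c b +ₚ (false ∷ a *ₚ b))
      ≈⟨ H-+ (d + e) (scale c b) (false ∷ a *ₚ b) ⟩
    H (d + e) (scale c b) +ₚ (scale false (v ^ₚ (d + e)) +ₚ (u *ₚ H (d + e ∸ 1) (a *ₚ b)))
      ≈⟨ +-cong (≈-trans (H-scale (d + e) c b) (scale-cong c (H-pad d db)))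
                (+-cong (scale-false (v ^ₚ (d + e))) (lower d da)) ⟩
    scale c ((v ^ₚ d) *ₚ H e b) +ₚ (u *ₚ (H (d ∸ 1) a *ₚ H e b))
      ≈⟨ +-cong (≈-sym (scale-*ˡ c (v ^ₚ d) (H e b))) (≈-sym (*-assoc u (H (d ∸ 1) a) (H e b))) ⟩
    (scale c (v ^ₚ d) *ₚ H e b) +ₚ ((u *ₚ H (d ∸ 1) a) *ₚ H e b)
      ≈⟨ ≈-sym (*-distribʳ (H e b) (scale c (v ^ₚ d)) (u *ₚ H (d ∸ 1) a)) ⟩
    H d (c ∷ a) *ₚ H e b ∎
    where
    lower : ∀ d → Deg≤ d (c ∷ a) → u *ₚ H (d + e ∸ 1) (a *ₚ b) ≈ u *ₚ (H (d ∸ 1) a *ₚ H e b)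
    lower zero    da = ≈-trans (*-≈[]ʳ u (H-zero (e ∸ 1) (*-congˡ b a≈[])))
                               (≈-sym (*-≈[]ʳ u (*-congˡ (H e b) (H-zero 0 a≈[]))))
      where a≈[] = Deg≤0-tail da
    lower (suc d) da = *-congʳ u (H-* d e (Deg≤-tail da) db)

  H-deg : Deg≤ 1 u → Deg≤ 1 v → ∀ d {p} → Deg≤ d p → Deg≤ d (H d p)
  H-deg du dv d {[]}    dp = Deg≤-zero ≈-refl
  H-deg du dv d {c ∷ p} dp = Deg≤-+ (Deg≤-scale c (Deg≤-^ d dv)) (lower d dp)
    where
    lower : ∀ d → Deg≤ d (c ∷ p) → Deg≤ d (u *ₚ H (d ∸ 1) p)
    lower zero    dp = Deg≤-zero (*-≈[]ʳ u (H-zero 0 (Deg≤0-tail dp)))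
    lower (suc d) dp = Deg≤-* du (H-deg du dv d (Deg≤-tail dp))

  H-^ : ∀ {w} m → Deg≤ 1 w → H m (w ^ₚ m) ≈ H 1 w ^ₚ m
  H-^ zero    dw = ≈-trans (+-cong (scale-true one) (*-zeroʳ u)) (+-identityʳ one)
  H-^ {w} (suc m) dw = ≈-trans (H-* 1 m dw (Deg≤-^ m dw)) (*-congʳ (H 1 w) (H-^ m dw))

homog-∘ : ∀ {u v u′ v′} → Deg≤ 1 u′ → Deg≤ 1 v′ → ∀ d {p} → Deg≤ d p →
          homog u v d (homog u′ v′ d p) ≈ homog (homog u v 1 u′) (homog u v 1 v′) d p
homog-∘                 du′ dv′ d {[]}    dp = ≈-refl
homog-∘ {u} {v} {u′} {v′} du′ dv′ d {c ∷ p} dp = begin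
  H d (scale c (v′ ^ₚ d) +ₚ (u′ *ₚ H′ (d ∸ 1) p))
    ≈⟨ H-+ d (scale c (v′ ^ₚ d)) (u′ *ₚ H′ (d ∸ 1) p) ⟩
  H d (scale c (v′ ^ₚ d)) +ₚ H d (u′ *ₚ H′ (d ∸ 1) p)
    ≈⟨ +-cong (≈-trans (H-scale d c (v′ ^ₚ d)) (scale-cong c (H-^ d dv′))) (lower d dp) ⟩
  homog U V d (c ∷ p) ∎
  where
  open Homog u v
  H′ = homog u′ v′
  U = H 1 u′
  V = H 1 v′
  lower : ∀ d → Deg≤ d (c ∷ p) → H d (u′ *ₚ H′ (d ∸ 1) p) ≈ U *ₚ homog U V (d ∸ 1) p
  lower zero    dp = ≈-trans (H-zero 0 (*-≈[]ʳ u′ (Homog.H-zero u′ v′ 0 p≈[])))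
                             (≈-sym (*-≈[]ʳ U (Homog.H-zero U V 0 p≈[])))
    where p≈[] = Deg≤0-tail dp
  lower (suc d) dp = begin
    H (suc d) (u′ *ₚ H′ d p)     ≈⟨ H-* 1 d du′ (Homog.H-deg u′ v′ du′ dv′ d (Deg≤-tail dp)) ⟩
    U *ₚ H d (H′ d p)           ≈⟨ *-congʳ U (homog-∘ du′ dv′ d (Deg≤-tail dp)) ⟩
    U *ₚ homog U V d p          ∎

homog-id : ∀ {U V} → U ≈ X → V ≈ one → ∀ d {p} → Deg≤ d p → homog U V d p ≈ p
homog-id         U≈X V≈one d {[]}    dp = ≈-refl
homog-id {U} {V} U≈X V≈one d {c ∷ p} dp = begin
  scale c (V ^ₚ d) +ₚ (U *ₚ homog U V (d ∸ 1) p)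
    ≈⟨ +-cong (scale-cong c (≈-trans (^-congˡ d V≈one) (one-^ d))) (lower d dp) ⟩
  scale c one +ₚ (false ∷ p)
    ≈⟨ ∷-cong (trans (xor-identityʳ _) (∧-identityʳ c)) ≈-refl ⟩
  c ∷ p ∎
  where
  lower : ∀ d → Deg≤ d (c ∷ p) → U *ₚ homog U V (d ∸ 1) p ≈ false ∷ p
  lower zero    dp = ≈-trans (*-≈[]ʳ U (Homog.H-zero U V 0 p≈[])) (≈-sym (∷-zero p≈[]))
    where p≈[] = Deg≤0-tail dp
  lower (suc d) dp = ≈-trans (*-cong U≈X (homog-id U≈X V≈one d (Deg≤-tail dp))) (X-* p)

sumBelow : ℕ → (ℕ → Poly) → Poly
sumBelow zero    t = []
sumBelow (suc m) t = t 0 +ₚ sumBelow m (t ∘ suc)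

sumₚ-applyUpTo : ∀ t g m → sumₚ t (applyUpTo g m) ≡ sumBelow m (t ∘ g)
sumₚ-applyUpTo t g zero    = refl
sumₚ-applyUpTo t g (suc m) = cong (t (g 0) +ₚ_) (sumₚ-applyUpTo t (g ∘ suc) m)

sumBelow-cong : ∀ m {t s} → (∀ k → t k ≈ s k) → sumBelow m t ≈ sumBelow m s
sumBelow-cong zero    t≈s = ≈-refl
sumBelow-cong (suc m) t≈s = +-cong (t≈s 0) (sumBelow-cong m (t≈s ∘ suc))

sumBelow-≈[] : ∀ m {t} → (∀ k → t k ≈ []) → sumBelow m t ≈ []
sumBelow-≈[] zero    t≈[] = ≈-refl
sumBelow-≈[] (suc m) t≈[] = +-cong (t≈[] 0) (sumBelow-≈[] m (t≈[] ∘ suc))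

sumBelow-*ˡ : ∀ u m t → sumBelow m (λ k → u *ₚ t k) ≈ u *ₚ sumBelow m t
sumBelow-*ˡ u zero    t = ≈-sym (*-zeroʳ u)
sumBelow-*ˡ u (suc m) t =
  ≈-trans (+-cong ≈-refl (sumBelow-*ˡ u m (t ∘ suc))) (≈-sym (*-distribˡ u (t 0) _))

module _ (u v : Poly) where

  homogTerm : ℕ → Poly → ℕ → Poly
  homogTerm n f k = scale (coeff f k) ((u ^ₚ k) *ₚ (v ^ₚ (n ∸ k)))

  sumBelow-homogTerm : ∀ n {f} → Deg≤ n f → sumBelow (suc n) (homogTerm n f) ≈ homog u v n f
  sumBelow-homogTerm n {[]}    df =
    sumBelow-≈[] (suc n) λ k → scale-false ((u ^ₚ k) *ₚ (v ^ₚ (n ∸ k)))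
  sumBelow-homogTerm n {c ∷ f} df =
    +-cong (scale-cong c (*-identityˡ (v ^ₚ n)))
           (≈-trans (sumBelow-cong n shift) (≈-trans (sumBelow-*ˡ u n (homogTerm (n ∸ 1) f))
                                                     (*-congʳ u (lower n df))))
    where
    shift : ∀ k → homogTerm n (c ∷ f) (suc k) ≈ u *ₚ homogTerm (n ∸ 1) f k
    shift k = begin
      scale (coeff f k) ((u *ₚ (u ^ₚ k)) *ₚ (v ^ₚ (n ∸ suc k)))
        ≈⟨ scale-cong (coeff f k) (≈-trans (*-assoc u (u ^ₚ k) _)
             (*-congʳ u (*-congʳ (u ^ₚ k) (≡⇒≈ (cong (v ^ₚ_) (sym (∸-+-assoc n 1 k))))))) ⟩
      scale (coeff f k) (u *ₚ ((u ^ₚ k) *ₚ (v ^ₚ (n ∸ 1 ∸ k))))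
        ≈⟨ ≈-sym (scale-*ʳ (coeff f k) u _) ⟩
      u *ₚ homogTerm (n ∸ 1) f k ∎
    lower : ∀ n → Deg≤ n (c ∷ f) → sumBelow n (homogTerm (n ∸ 1) f) ≈ homog u v (n ∸ 1) f
    lower zero    df = ≈-sym (Homog.H-zero u v 0 (Deg≤0-tail df))
    lower (suc n) df = sumBelow-homogTerm n (Deg≤-tail df)

Deg≤1-one : Deg≤ 1 one
Deg≤1-one = mkDeg≤ λ { (suc k) _ → refl }

Deg≤1-linear : ∀ a b → Deg≤ 1 (a ∷ b ∷ [])
Deg≤1-linear a b = mkDeg≤ λ { (suc (suc k)) _ → refl ; (suc zero) (s≤s ()) }

ψ-homog : ∀ n {f} → Deg≤ n f → ψ n f ≈ homog one X+1 n f
ψ-homog n {f} df = begin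
  ψ n f
    ≡⟨ sumₚ-applyUpTo _ id (suc n) ⟩
  sumBelow (suc n) (λ k → scale (coeff f k) (X+1 ^ₚ (n ∸ k)))
    ≈⟨ sumBelow-cong (suc n) (λ k → scale-cong (coeff f k) (≈-sym
         (≈-trans (*-congˡ (X+1 ^ₚ (n ∸ k)) (one-^ k)) (*-identityˡ (X+1 ^ₚ (n ∸ k)))))) ⟩
  sumBelow (suc n) (homogTerm one X+1 n f)
    ≈⟨ sumBelow-homogTerm one X+1 n df ⟩
  homog one X+1 n f ∎

ψinv-homog : ∀ n {f} → Deg≤ n f → ψinv n f ≈ homog X+1 X n f
ψinv-homog n df = ≈-trans (≡⇒≈ (sumₚ-applyUpTo _ id (suc n))) (sumBelow-homogTerm X+1 X n df)

homog-ψinv∘ψ : ∀ n {f} → Deg≤ n f → homog X+1 X n (homog one X+1 n f) ≈ f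
homog-ψinv∘ψ n df =
  ≈-trans (homog-∘ Deg≤1-one (Deg≤1-linear true true) n df) (homog-id U≈X V≈one n df)
  where
  U≈X : homog X+1 X 1 one ≈ X
  U≈X = mk≈ λ { 0 → refl ; 1 → refl ; 2 → refl ; 3 → refl ; (suc (suc (suc (suc k)))) → refl }
  V≈one : homog X+1 X 1 X+1 ≈ one
  V≈one = mk≈ λ { 0 → refl ; 1 → refl ; 2 → refl ; 3 → refl ; (suc (suc (suc (suc k)))) → refl }

homog-ψ∘ψinv : ∀ n {f} → Deg≤ n f → homog one X+1 n (homog X+1 X n f) ≈ f
homog-ψ∘ψinv n df =
  ≈-trans (homog-∘ (Deg≤1-linear true true) (Deg≤1-linear false true) n df)
          (homog-id U≈X V≈one n df)
  where
  U≈X : homog one X+1 1 X+1 ≈ X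
  U≈X = mk≈ λ { 0 → refl ; 1 → refl ; 2 → refl ; 3 → refl ; (suc (suc (suc (suc k)))) → refl }
  V≈one : homog one X+1 1 X ≈ one
  V≈one = mk≈ λ { 0 → refl ; 1 → refl ; 2 → refl ; 3 → refl ; (suc (suc (suc (suc k)))) → refl }

-- Irreducibility

true≢false : ¬ true ≡ false
true≢false ()

record Monic (d : ℕ) (p : Poly) : Set where
  constructor mkMonic
  field
    lead  : coeff p d ≡ true
    deg≤  : Deg≤ d p
open Monic public

fromMonicDeg : ∀ {d p} → MonicDeg d p → Monic d p
fromMonicDeg (lead , above) = mkMonic lead (mkDeg≤ above)

toMonicDeg : ∀ {d p} → Monic d p → MonicDeg d p
toMonicDeg (mkMonic lead dp) = lead , coeff-above dp

Monic-resp-≈ : ∀ {d p q} → p ≈ q → Monic d p → Monic d q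
Monic-resp-≈ {d} p≈q (mkMonic lead dp) =
  mkMonic (trans (sym (coeff-≈ p≈q d)) lead) (Deg≤-resp-≈ p≈q dp)

Monic-* : ∀ {d e a b} → Monic d a → Monic e b → Monic (d + e) (a *ₚ b)
Monic-* (mkMonic lead-a da) (mkMonic lead-b db) =
  mkMonic (trans (coeff-*-top da db) (cong₂ _∧_ lead-a lead-b)) (Deg≤-* da db)

Monic-unique : ∀ {d e p} → Monic d p → Monic e p → d ≡ e
Monic-unique {d} {e} (mkMonic lead-d above-d) (mkMonic lead-e above-e) with <-cmp d e
... | tri< d<e _ _ = ⊥-elim (true≢false (trans (sym lead-e) (coeff-above above-d e d<e)))
... | tri≈ _ d≡e _ = d≡e
... | tri> _ _ e<d = ⊥-elim (true≢false (trans (sym lead-d) (coeff-above above-e d e<d)))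

∧-true : ∀ {a b} → a ∧ b ≡ true → (a ≡ true) × (b ≡ true)
∧-true {true} {true} _ = refl , refl

Irreducible-reflect : ∀ {u v n f g} → Deg≤ 1 u → Deg≤ 1 v →
                      Monic n g → homog u v n g ≈ f → Irreducible n f → Irreducible n g
Irreducible-reflect {u} {v} {n} {f} {g} du dv mg Hg≈f (1≤n , mf , irreducible-f) =
  1≤n , toMonicDeg mg , λ { (d , e , a , b , 1≤d , 1≤e , ma , mb , ab≈g) → irreducible-f
    (d , e , H d a , H e b , 1≤d , 1≤e ,
     factors {a = a} {b} (fromMonicDeg ma) (fromMonicDeg mb) (mk≈ ab≈g)) }
  where
  open Homog u v
  factors : ∀ {d e a b} → Monic d a → Monic e b → a *ₚ b ≈ g →
            MonicDeg d (H d a) × MonicDeg e (H e b) × (H d a *ₚ H e b) ≈ₚ f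
  factors {d} {e} {a} {b} ma mb ab≈g =
    (proj₁ leads , coeff-above dHa) , (proj₂ leads , coeff-above dHb) , coeff-≈ HaHb≈f
    where
    d+e≡n = Monic-unique (Monic-resp-≈ ab≈g (Monic-* ma mb)) mg
    dHa = H-deg du dv d (deg≤ ma)
    dHb = H-deg du dv e (deg≤ mb)
    HaHb≈f : H d a *ₚ H e b ≈ f
    HaHb≈f = begin
      H d a *ₚ H e b      ≈⟨ ≈-sym (H-* d e (deg≤ ma) (deg≤ mb)) ⟩
      H (d + e) (a *ₚ b)  ≈⟨ H-cong (d + e) ab≈g ⟩
      H (d + e) g         ≡⟨ cong (λ m → H m g) d+e≡n ⟩
      H n g               ≈⟨ Hg≈f ⟩
      f                   ∎
    leads : (coeff (H d a) d ≡ true) × (coeff (H e b) e ≡ true)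
    leads = ∧-true (trans (sym (coeff-*-top dHa dHb))
                   (trans (coeff-≈ HaHb≈f (d + e)) (trans (cong (coeff f) d+e≡n) (proj₁ mf))))

Irreducible⇒coeff₀ : ∀ {n} f → 2 ≤ n → Irreducible n f → coeff f 0 ≡ true
Irreducible⇒coeff₀ []         _ (_ , (() , _) , _)
Irreducible⇒coeff₀ (true ∷ p) _ _ = refl
Irreducible⇒coeff₀ {suc n} (false ∷ p) (s≤s 1≤n) (_ , (lead , above) , irreducible) =
  ⊥-elim (irreducible (1 , n , X , p , s≤s z≤n , 1≤n ,
    toMonicDeg (mkMonic refl (Deg≤1-linear false true)) ,
    toMonicDeg (mkMonic lead (Deg≤-tail (mkDeg≤ above))) , coeff-≈ (X-* p)))

-- Coefficients of ψ(f) and ψ⁻¹(f)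

parity-suc : ∀ m → parity (suc m) ≡ not (parity m)
parity-suc zero          = refl
parity-suc (suc zero)    = refl
parity-suc (suc (suc m)) = parity-suc m

parity-+ : ∀ a b → parity (a + b) ≡ parity a xor parity b
parity-+ zero          b = refl
parity-+ (suc zero)    b = parity-suc b
parity-+ (suc (suc a)) b = parity-+ a b

xor≡true⇒≡not : ∀ {a b} → a xor b ≡ true → a ≡ not b
xor≡true⇒≡not {false} {true}  _ = refl
xor≡true⇒≡not {true}  {false} _ = refl

parity-∸ : ∀ {n k} → k ≤ n → Odd n → parity (n ∸ k) ≡ not (parity k)
parity-∸ {n} {k} k≤n odd = xor≡true⇒≡not
  (trans (sym (parity-+ (n ∸ k) k)) (trans (cong parity (m∸n+n≡m k≤n)) odd))

X+1-* : ∀ p → X+1 *ₚ p ≈ p +ₚ (false ∷ p)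
X+1-* p = +-cong (scale-true p) (∷-cong refl (*-identityˡ p))

Deg≤-X+1^ : ∀ m → Deg≤ m (X+1 ^ₚ m)
Deg≤-X+1^ m = Deg≤-^ m (Deg≤1-linear true true)

coeff-X+1^-suc : ∀ m j →
  coeff (X+1 ^ₚ suc m) (suc j) ≡ coeff (X+1 ^ₚ m) (suc j) xor coeff (X+1 ^ₚ m) j
coeff-X+1^-suc m j = trans (coeff-≈ (X+1-* (X+1 ^ₚ m)) (suc j)) (coeff-+ (X+1 ^ₚ m) _ (suc j))

coeff-X+1^-0 : ∀ m → coeff (X+1 ^ₚ m) 0 ≡ true
coeff-X+1^-0 zero    = refl
coeff-X+1^-0 (suc m) = trans (coeff-≈ (X+1-* (X+1 ^ₚ m)) 0)
                       (trans (coeff-+ (X+1 ^ₚ m) _ 0) (trans (xor-identityʳ _) (coeff-X+1^-0 m)))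

coeff-X+1^-1 : ∀ m → coeff (X+1 ^ₚ m) 1 ≡ parity m
coeff-X+1^-1 zero    = refl
coeff-X+1^-1 (suc m) = trans (coeff-X+1^-suc m 0)
  (trans (cong₂ _xor_ (coeff-X+1^-1 m) (coeff-X+1^-0 m))
         (trans (xor-comm (parity m) true) (sym (parity-suc m))))

coeff-X+1^-above : ∀ {m j} → m < j → coeff (X+1 ^ₚ m) j ≡ false
coeff-X+1^-above {m} {j} = coeff-above (Deg≤-X+1^ m) j

coeff-X+1^-top : ∀ m → coeff (X+1 ^ₚ m) m ≡ true
coeff-X+1^-top m = coeff-^-top m (Deg≤1-linear true true) refl

coeff-X+1^-sub : ∀ m → coeff (X+1 ^ₚ suc m) m ≡ parity (suc m)
coeff-X+1^-sub zero    = refl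
coeff-X+1^-sub (suc m) = trans (coeff-X+1^-suc (suc m) m)
  (trans (cong₂ _xor_ (coeff-X+1^-top (suc m)) (coeff-X+1^-sub m)) (sym (parity-suc (suc m))))

*-X^-suc : ∀ p j → p *ₚ (X ^ₚ suc j) ≈ false ∷ p *ₚ (X ^ₚ j)
*-X^-suc p j = ≈-trans (*-leftSwap p X (X ^ₚ j)) (X-* (p *ₚ (X ^ₚ j)))

coeff-*-X^ : ∀ p j i → coeff (p *ₚ (X ^ₚ j)) (j + i) ≡ coeff p i
coeff-*-X^ p zero    i = coeff-≈ (*-identityʳ p) i
coeff-*-X^ p (suc j) i = trans (coeff-≈ (*-X^-suc p j) (suc (j + i))) (coeff-*-X^ p j i)

coeff-*-X^-below : ∀ p {j i} → i < j → coeff (p *ₚ (X ^ₚ j)) i ≡ false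
coeff-*-X^-below p {suc j} {zero}  _           = coeff-≈ (*-X^-suc p j) zero
coeff-*-X^-below p {suc j} {suc i} (s≤s i<j)   =
  trans (coeff-≈ (*-X^-suc p j) (suc i)) (coeff-*-X^-below p i<j)

xorBelow : ℕ → (ℕ → Bool) → Bool
xorBelow zero    t = false
xorBelow (suc m) t = t 0 xor xorBelow m (t ∘ suc)

xorBelow-cong : ∀ m {t s} → (∀ k → k < m → t k ≡ s k) → xorBelow m t ≡ xorBelow m s
xorBelow-cong zero    t≡s = refl
xorBelow-cong (suc m) t≡s =
  cong₂ _xor_ (t≡s 0 (s≤s z≤n)) (xorBelow-cong m λ k k<m → t≡s (suc k) (s≤s k<m))

xorBelow-false : ∀ m {t} → (∀ k → k < m → t k ≡ false) → xorBelow m t ≡ false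
xorBelow-false m t≡false = trans (xorBelow-cong m t≡false) (xorBelow-const m)
  where
  xorBelow-const : ∀ m → xorBelow m (λ _ → false) ≡ false
  xorBelow-const zero    = refl
  xorBelow-const (suc m) = xorBelow-const m

xorBelow-xor : ∀ m t s → xorBelow m (λ k → t k xor s k) ≡ xorBelow m t xor xorBelow m s
xorBelow-xor zero    t s = refl
xorBelow-xor (suc m) t s = trans (cong ((t 0 xor s 0) xor_) (xorBelow-xor m (t ∘ suc) (s ∘ suc)))
                                 (xor-interchange (t 0) (s 0) _ _)

xorBelow-suc : ∀ m t → xorBelow (suc m) t ≡ xorBelow m t xor t m
xorBelow-suc zero    t = xor-comm (t 0) false
xorBelow-suc (suc m) t =
  trans (cong (t 0 xor_) (xorBelow-suc m (t ∘ suc))) (sym (xor-assoc (t 0) _ _))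

coeff-sumBelow : ∀ m t j → coeff (sumBelow m t) j ≡ xorBelow m (λ k → coeff (t k) j)
coeff-sumBelow zero    t j = refl
coeff-sumBelow (suc m) t j =
  trans (coeff-+ (t 0) _ j) (cong (coeff (t 0) j xor_) (coeff-sumBelow m (t ∘ suc) j))

coeff-sum-scale : ∀ (c : ℕ → Bool) (q : ℕ → Poly) m j →
  coeff (sumₚ (λ k → scale (c k) (q k)) (upTo m)) j ≡ xorBelow m (λ k → c k ∧ coeff (q k) j)
coeff-sum-scale c q m j =
  trans (cong (λ p → coeff p j) (sumₚ-applyUpTo (λ k → scale (c k) (q k)) id m))
  (trans (coeff-sumBelow m (λ k → scale (c k) (q k)) j)
         (xorBelow-cong m λ k _ → coeff-scale (c k) (q k) j))

-- f(1) and f′(1) = Σₖ k fₖ in F₂, for deg f ≤ n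
eval₁ : ℕ → Poly → Bool
eval₁ n f = xorBelow (suc n) (coeff f)

deriv₁ : ℕ → Poly → Bool
deriv₁ n f = xorBelow (suc n) (λ k → parity k ∧ coeff f k)

coeff-ψ : ∀ n f j → coeff (ψ n f) j ≡ xorBelow (suc n) (λ k → coeff f k ∧ coeff (X+1 ^ₚ (n ∸ k)) j)
coeff-ψ n f = coeff-sum-scale (coeff f) (λ k → X+1 ^ₚ (n ∸ k)) (suc n)

coeff-ψinv : ∀ n f j →
  coeff (ψinv n f) j ≡ xorBelow (suc n) (λ k → coeff f k ∧ coeff ((X+1 ^ₚ k) *ₚ (X ^ₚ (n ∸ k))) j)
coeff-ψinv n f = coeff-sum-scale (coeff f) (λ k → (X+1 ^ₚ k) *ₚ (X ^ₚ (n ∸ k))) (suc n)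

∧-≡trueʳ : ∀ b {x} → x ≡ true → b ∧ x ≡ b
∧-≡trueʳ b x≡true = trans (cong (b ∧_) x≡true) (∧-identityʳ b)

∧-≡falseʳ : ∀ b {x} → x ≡ false → b ∧ x ≡ false
∧-≡falseʳ b x≡false = trans (cong (b ∧_) x≡false) (∧-zeroʳ b)

∧-not : ∀ a b → a ∧ not b ≡ a xor (b ∧ a)
∧-not a b = trans (∧-distribˡ-xor a true b) (cong₂ _xor_ (∧-identityʳ a) (∧-comm a b))

n∸1+k<n : ∀ {n k} → k < n → n ∸ suc k < n
n∸1+k<n {suc n} {k} _ = s≤s (m∸n≤m n k)

coeff-*-X^-∸ : ∀ p {n k} → k ≤ n → coeff (p *ₚ (X ^ₚ (n ∸ k))) n ≡ coeff p k
coeff-*-X^-∸ p {n} {k} k≤n =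
  trans (cong (coeff (p *ₚ (X ^ₚ (n ∸ k)))) (sym (m∸n+n≡m k≤n))) (coeff-*-X^ p (n ∸ k) k)

coeff-ψ-top : ∀ n f → coeff (ψ n f) n ≡ coeff f 0
coeff-ψ-top n f = trans (coeff-ψ n f n) (trans
  (cong₂ _xor_ (∧-≡trueʳ (coeff f 0) (coeff-X+1^-top n))
               (xorBelow-false n λ k k<n →
                 ∧-≡falseʳ (coeff f (suc k)) (coeff-X+1^-above (n∸1+k<n k<n))))
  (xor-identityʳ _))

coeff-ψ-0 : ∀ n f → coeff (ψ n f) 0 ≡ eval₁ n f
coeff-ψ-0 n f = trans (coeff-ψ n f 0)
  (xorBelow-cong (suc n) λ k _ → ∧-≡trueʳ (coeff f k) (coeff-X+1^-0 (n ∸ k)))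

coeff-ψ-sub : ∀ n f → coeff (ψ (suc n) f) n ≡ (coeff f 0 ∧ parity (suc n)) xor coeff f 1
coeff-ψ-sub n f = trans (coeff-ψ (suc n) f n) (cong₂ _xor_
  (cong (coeff f 0 ∧_) (coeff-X+1^-sub n))
  (trans (cong₂ _xor_ (∧-≡trueʳ (coeff f 1) (coeff-X+1^-top n))
                      (xorBelow-false n λ k k<n →
                        ∧-≡falseʳ (coeff f (2 + k)) (coeff-X+1^-above (n∸1+k<n k<n))))
         (xor-identityʳ _)))

coeff-ψ-1 : ∀ n f → Odd n → coeff (ψ n f) 1 ≡ eval₁ n f xor deriv₁ n f
coeff-ψ-1 n f odd = trans (coeff-ψ n f 1) (trans (xorBelow-cong (suc n) term)
  (xorBelow-xor (suc n) (coeff f) (λ k → parity k ∧ coeff f k)))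
  where
  term : ∀ k → k < suc n →
         coeff f k ∧ coeff (X+1 ^ₚ (n ∸ k)) 1 ≡ coeff f k xor (parity k ∧ coeff f k)
  term k (s≤s k≤n) = trans (cong (coeff f k ∧_) (trans (coeff-X+1^-1 (n ∸ k)) (parity-∸ k≤n odd)))
                           (∧-not (coeff f k) (parity k))

coeff-ψinv-top : ∀ n f → coeff (ψinv n f) n ≡ eval₁ n f
coeff-ψinv-top n f = trans (coeff-ψinv n f n) (xorBelow-cong (suc n) λ { k (s≤s k≤n) →
  ∧-≡trueʳ (coeff f k) (trans (coeff-*-X^-∸ (X+1 ^ₚ k) k≤n) (coeff-X+1^-top k)) })

coeff-ψinv-sub : ∀ n f → coeff (ψinv (suc n) f) n ≡ deriv₁ (suc n) f
coeff-ψinv-sub n f = trans (coeff-ψinv (suc n) f n) (xorBelow-cong (suc (suc n)) term)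
  where
  term : ∀ k → k < suc (suc n) →
         coeff f k ∧ coeff ((X+1 ^ₚ k) *ₚ (X ^ₚ (suc n ∸ k))) n ≡ parity k ∧ coeff f k
  term zero    _               = ∧-≡falseʳ (coeff f 0) (coeff-*-X^-below one (n<1+n n))
  term (suc k) (s≤s (s≤s k≤n)) =
    trans (cong (coeff f (suc k) ∧_) (trans (coeff-*-X^-∸ (X+1 ^ₚ suc k) k≤n) (coeff-X+1^-sub k)))
          (∧-comm (coeff f (suc k)) _)

coeff-ψinv-1 : ∀ n f →
  coeff (ψinv (2 + n) f) 1 ≡ coeff f (1 + n) xor (parity (2 + n) ∧ coeff f (2 + n))
coeff-ψinv-1 n f = trans (coeff-ψinv (2 + n) f 1) (trans (xorBelow-suc (2 + n) t)
  (cong₂ _xor_ (trans (xorBelow-suc (1 + n) t) (cong₂ _xor_ low middle)) top))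
  where
  t : ℕ → Bool
  t k = coeff f k ∧ coeff ((X+1 ^ₚ k) *ₚ (X ^ₚ (2 + n ∸ k))) 1
  t-at : ∀ {k j} → 2 + n ∸ k ≡ j → t k ≡ coeff f k ∧ coeff ((X+1 ^ₚ k) *ₚ (X ^ₚ j)) 1
  t-at refl = refl
  low : xorBelow (1 + n) t ≡ false
  low = xorBelow-false (1 + n) λ { k (s≤s k≤n) → trans (t-at (+-∸-assoc 2 k≤n))
    (∧-≡falseʳ (coeff f k) (coeff-*-X^-below (X+1 ^ₚ k) {2 + (n ∸ k)} (s≤s (s≤s z≤n)))) }
  middle : t (1 + n) ≡ coeff f (1 + n)
  middle = trans (t-at (m+n∸n≡m 1 (1 + n))) (∧-≡trueʳ (coeff f (1 + n))
    (trans (coeff-*-X^ (X+1 ^ₚ (1 + n)) 1 0) (coeff-X+1^-0 (1 + n))))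
  top : t (2 + n) ≡ parity (2 + n) ∧ coeff f (2 + n)
  top = trans (t-at (n∸n≡0 n))
    (trans (cong (coeff f (2 + n) ∧_)
                 (trans (coeff-*-X^ (X+1 ^ₚ (2 + n)) 0 1) (coeff-X+1^-1 (2 + n))))
           (∧-comm (coeff f (2 + n)) _))

foldr-xor-applyUpTo : ∀ (t : ℕ → Bool) g m →
  foldr (λ k acc → t k xor acc) false (applyUpTo g m) ≡ xorBelow m (t ∘ g)
foldr-xor-applyUpTo t g zero    = refl
foldr-xor-applyUpTo t g (suc m) = cong (t (g 0) xor_) (foldr-xor-applyUpTo t (g ∘ suc) m)

σ-xorBelow : ∀ m f → σ (3 + m) f ≡ xorBelow m (λ k → parity (2 + k) ∧ coeff f (2 + k))
σ-xorBelow m f = trans (foldr-map (λ k acc → (parity k ∧ coeff f k) xor acc) (2 +_) false (upTo m))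
                       (foldr-xor-applyUpTo (λ k → parity (2 + k) ∧ coeff f (2 + k)) id m)

Odd[3+m]⇒parity[m]≡false : ∀ m → Odd (3 + m) → parity m ≡ false
Odd[3+m]⇒parity[m]≡false m odd =
  trans (sym (not-involutive (parity m))) (cong not (trans (sym (parity-suc m)) odd))

deriv₁-σ : ∀ m f → Odd (3 + m) → coeff f (3 + m) ≡ true →
           deriv₁ (3 + m) f ≡ coeff f 1 xor not (σ (3 + m) f)
deriv₁-σ m f odd lead = cong (coeff f 1 xor_) (trans (xorBelow-suc (1 + m) t) (trans (cong₂ _xor_
  (trans (xorBelow-suc m t)
         (trans (cong₂ _xor_ (sym (σ-xorBelow m f)) (cong (_∧ coeff f (2 + m)) even))
                (xor-identityʳ (σ (3 + m) f))))
  (trans (cong (_∧ coeff f (3 + m)) (trans (parity-suc m) (cong not even))) lead))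
  (xor-comm (σ (3 + m) f) true)))
  where
  even : parity m ≡ false
  even = Odd[3+m]⇒parity[m]≡false m odd
  t : ℕ → Bool
  t k = parity (2 + k) ∧ coeff f (2 + k)

-- The classes of ψ(h) and ψ⁻¹(h)

Irreducible-ψ : ∀ n h → 2 ≤ n → Irreducible n h → Irreducible n (ψ n h)
Irreducible-ψ n h 2≤n irr@(_ , mh , _) =
  Irreducible-reflect (Deg≤1-linear true true) (Deg≤1-linear false true) monic
    (≈-trans (Homog.H-cong X+1 X n (ψ-homog n dh)) (homog-ψinv∘ψ n dh)) irr
  where
  dh : Deg≤ n h
  dh = deg≤ (fromMonicDeg mh)
  monic : Monic n (ψ n h)
  monic = mkMonic (trans (coeff-ψ-top n h) (Irreducible⇒coeff₀ h 2≤n irr))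
    (Deg≤-resp-≈ (≈-sym (ψ-homog n dh))
                 (Homog.H-deg one X+1 Deg≤1-one (Deg≤1-linear true true) n dh))

eval₁-irreducible : ∀ n h → 2 ≤ n → Irreducible n h → eval₁ n h ≡ true
eval₁-irreducible n h 2≤n irr =
  trans (sym (coeff-ψ-0 n h)) (Irreducible⇒coeff₀ (ψ n h) 2≤n (Irreducible-ψ n h 2≤n irr))

Irreducible-ψinv : ∀ n h → 2 ≤ n → Irreducible n h → Irreducible n (ψinv n h)
Irreducible-ψinv n h 2≤n irr@(_ , mh , _) =
  Irreducible-reflect Deg≤1-one (Deg≤1-linear true true) monic
    (≈-trans (Homog.H-cong one X+1 n (ψinv-homog n dh)) (homog-ψ∘ψinv n dh)) irr
  where
  dh : Deg≤ n h
  dh = deg≤ (fromMonicDeg mh)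
  monic : Monic n (ψinv n h)
  monic = mkMonic (trans (coeff-ψinv-top n h) (eval₁-irreducible n h 2≤n irr))
    (Deg≤-resp-≈ (≈-sym (ψinv-homog n dh))
                 (Homog.H-deg X+1 X (Deg≤1-linear true true) (Deg≤1-linear false true) n dh))

ψ-∈S : ∀ n h {i s} → 3 ≤ n → Odd n → Irreducible n h → coeff h 1 ≡ i → σ n h ≡ s →
       S (not i) (i xor s) n (ψ n h)
ψ-∈S (suc (suc (suc m))) h (s≤s (s≤s (s≤s _))) odd irr@(_ , (lead , _) , _) refl refl =
  Irreducible-ψ n h 2≤n irr , coeff-sub , coeff-1
  where
  n : ℕ
  n = 3 + m
  2≤n : 2 ≤ n
  2≤n = s≤s (s≤s z≤n)
  coeff-sub : coeff (ψ n h) (2 + m) ≡ not (coeff h 1)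
  coeff-sub = trans (coeff-ψ-sub (2 + m) h)
                    (cong₂ (λ a b → (a ∧ b) xor coeff h 1) (Irreducible⇒coeff₀ h 2≤n irr) odd)
  coeff-1 : coeff (ψ n h) 1 ≡ coeff h 1 xor σ n h
  coeff-1 = trans (coeff-ψ-1 n h odd)
    (trans (cong₂ _xor_ (eval₁-irreducible n h 2≤n irr) (deriv₁-σ m h odd lead))
           (trans (not-distribʳ-xor (coeff h 1) (not (σ n h)))
                  (cong (coeff h 1 xor_) (not-involutive (σ n h)))))

ψinv-∈S : ∀ n h {i j s} → 3 ≤ n → Odd n → Irreducible n h →
          coeff h 1 ≡ i → coeff h (n ∸ 1) ≡ j → σ n h ≡ s → S (i xor not s) (not j) n (ψinv n h)
ψinv-∈S (suc (suc (suc m))) h (s≤s (s≤s (s≤s _))) odd irr@(_ , (lead , _) , _) refl refl refl =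
  Irreducible-ψinv n h (s≤s (s≤s z≤n)) irr , coeff-sub , coeff-1
  where
  n : ℕ
  n = 3 + m
  coeff-sub : coeff (ψinv n h) (2 + m) ≡ coeff h 1 xor not (σ n h)
  coeff-sub = trans (coeff-ψinv-sub (2 + m) h) (deriv₁-σ m h odd lead)
  coeff-1 : coeff (ψinv n h) 1 ≡ not (coeff h (2 + m))
  coeff-1 = trans (coeff-ψinv-1 (1 + m) h)
    (trans (cong₂ (λ a b → coeff h (2 + m) xor (a ∧ b)) odd lead) (xor-comm (coeff h (2 + m)) true))

lemma1 : (n : ℕ) → 3 ≤ n → Odd n → (f g : Poly) → S true true n f → S false false n g →
    ((σ n f ≡ true → S false false n (ψ n f)) × (σ n f ≡ false → S false true n (ψ n f)))
    × ((σ n f ≡ false → S false false n (ψinv n f)) × (σ n f ≡ true → S true false n (ψinv n f)))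
    × ((σ n g ≡ true → S true true n (ψ n g)) × (σ n g ≡ false → S true false n (ψ n g)))
    × ((σ n g ≡ false → S true true n (ψinv n g)) × (σ n g ≡ true → S false true n (ψinv n g)))
lemma1 n 3≤n odd f g (irr-f , fₙ₋₁ , f₁) (irr-g , gₙ₋₁ , g₁) =
  (ψ-∈S n f 3≤n odd irr-f f₁ , ψ-∈S n f 3≤n odd irr-f f₁) ,
  (ψinv-∈S n f 3≤n odd irr-f f₁ fₙ₋₁ , ψinv-∈S n f 3≤n odd irr-f f₁ fₙ₋₁) ,
  (ψ-∈S n g 3≤n odd irr-g g₁ , ψ-∈S n g 3≤n odd irr-g g₁) ,
  (ψinv-∈S n g 3≤n odd irr-g g₁ gₙ₋₁ , ψinv-∈S n g 3≤n odd irr-g g₁ gₙ₋₁)
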